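{- Let $G$ be a connected graph of order $n\ge 4$. Then (1) $\tau_{n-1}(G)=1$ if and only if $G$ is the complete graph $K_n$; (2) $\tau_{n-1}(G)=0$ if and only if $G$ is not complete.
   Context: For $S\subseteq V(G)$ with $|S|\ge 2$, a pedant $S$-Steiner tree is a subgraph of $G$ that is a tree containing $S$ in which every vertex of $S$ has degree exactly one. Two pedant $S$-Steiner trees $T,T'$ are internally disjoint if $E(T)\cap E(T')=\emptyset$ and $V(T)\cap V(T')=S$. $\tau_G(S)$ is the maximum number of pairwise internally disjoint pedant $S$-Steiner trees in $G$, and $\tau_k(G)=\min\{\tau_G(S): S\subseteq V(G),\ |S|=k\}$. -}

module Defs where

open import Data.Nat using (ℕ; _≤_; _+_; suc)
open import Data.Fin using (Fin)
open import Data.Fin.Subset using (Subset; _∈_; ∣_∣)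
open import Data.Bool using (Bool; true; false)
open import Data.List using (List; []; _∷_; length; filterᵇ; allFin)
open import Data.List.Relation.Unary.Unique.Propositional using (Unique)
open import Data.Product using (_×_; Σ; ∃)
open import Relation.Binary.PropositionalEquality using (_≡_; _≢_)
open import Relation.Nullary using (¬_)
open import Data.Empty using (⊥)

record Graph (n : ℕ) : Set where
  field
    adj    : Fin n → Fin n → Bool
    sym    : ∀ u v → adj u v ≡ true → adj v u ≡ true
    irrefl : ∀ v → adj v v ≡ false
open Graph public

data Reach {n : ℕ} (E : Fin n → Fin n → Bool) : Fin n → Fin n → Set where
  here : ∀ {u} → Reach E u u
  step : ∀ {u v w} → E u v ≡ true → Reach E v w → Reach E u w

Connected : ∀ {n} → Graph n → Set
Connected {n} G = ∀ (u v : Fin n) → Reach (adj G) u v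

Complete : ∀ {n} → Graph n → Set
Complete {n} G = ∀ (u v : Fin n) → u ≢ v → adj G u v ≡ true

record Subgraph {n : ℕ} (G : Graph n) : Set where
  field
    vset     : Subset n
    eset     : Fin n → Fin n → Bool
    esym     : ∀ u v → eset u v ≡ true → eset v u ≡ true
    e⊆G      : ∀ u v → eset u v ≡ true → adj G u v ≡ true
    e-endpts : ∀ u v → eset u v ≡ true → (u ∈ vset) × (v ∈ vset)
open Subgraph public

data Chain {n : ℕ} (E : Fin n → Fin n → Bool) : List (Fin n) → Set where
  [] : Chain E []
  [-] : ∀ {v} → Chain E (v ∷ [])
  _∷_ : ∀ {u v vs} → E u v ≡ true → Chain E (v ∷ vs) → Chain E (u ∷ v ∷ vs)

IsCycle : ∀ {n} → (Fin n → Fin n → Bool) → List (Fin n) → Set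
IsCycle E [] = ⊥
IsCycle E (v ∷ vs) =
  (3 ≤ length (v ∷ vs)) × Unique (v ∷ vs) × Chain E (v ∷ vs) × (E (last v vs) v ≡ true)
  where
    last : _ → List _ → _
    last x [] = x
    last x (y ∷ ys) = last y ys

IsTree : ∀ {n} {G : Graph n} → Subgraph G → Set
IsTree {n} T =
  (∀ u v → u ∈ vset T → v ∈ vset T → Reach (eset T) u v)
  × (∀ (c : List (Fin n)) → ¬ IsCycle (eset T) c)

degree : ∀ {n} {G : Graph n} → Subgraph G → Fin n → ℕ
degree {n} T v = length (filterᵇ (eset T v) (allFin n))

IsPedantSteiner : ∀ {n} {G : Graph n} → Subset n → Subgraph G → Set
IsPedantSteiner {n} S T =
  IsTree T × (∀ v → v ∈ S → v ∈ vset T) × (∀ v → v ∈ S → degree T v ≡ 1)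

InternallyDisjoint : ∀ {n} {G : Graph n} → Subset n → Subgraph G → Subgraph G → Set
InternallyDisjoint {n} S T T' =
  (∀ u v → eset T u v ≡ true → eset T' u v ≡ false)
  × (∀ v → (v ∈ vset T × v ∈ vset T') → v ∈ S)
  × (∀ v → v ∈ S → v ∈ vset T × v ∈ vset T')

HasPacking : ∀ {n} → Graph n → Subset n → ℕ → Set
HasPacking G S m =
  Σ (Fin m → Subgraph G) λ T →
    (∀ i → IsPedantSteiner S (T i))
    × (∀ i j → i ≢ j → InternallyDisjoint S (T i) (T j))

-- τ_G(S) = m : m is the maximum size of such a packing.
TauS≡ : ∀ {n} → Graph n → Subset n → ℕ → Set
TauS≡ G S m = HasPacking G S m × ¬ HasPacking G S (suc m)

-- τ_k(G) = m : the minimum of τ_G(S) over all S with |S| = k equals m.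
Tau≡ : ∀ {n} → Graph n → ℕ → ℕ → Set
Tau≡ {n} G k m =
  (∀ (S : Subset n) → ∣ S ∣ ≡ k → HasPacking G S m)
  × ∃ λ (S : Subset n) → (∣ S ∣ ≡ k) × TauS≡ G S m

module Submission where

-- Let n ≥ 4 and x a vertex of G.  The whole corollary rests on one structural fact
-- about S = V(G) ∖ {x} (the only shape an (n-1)-set can have):
--   in every pedant S-Steiner tree T, every vertex v ≠ x is joined to x.
-- Indeed v has a unique T-neighbour w; if w ≠ x then w ∈ S has v as its unique
-- T-neighbour, so {v, w} is closed under T-edges, yet T must also reach a third
-- terminal z ∉ {x, v, w}, which exists because n ≥ 4.
-- Consequently (a) a pedant S-tree forces every edge vx into G, and (b) any two
-- pedant S-trees share the non-terminal x, so τ_G(S) ≤ 1.  Conversely, in K_n the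
-- star centred at x is a pedant S-tree.  Hence τ_{n-1}(G) = 1 when G is complete,
-- and when some pair u, v is non-adjacent the set V(G) ∖ {v} has no pedant tree.

open import Defs hiding (sym)
open import Data.Nat using (ℕ; _≤_; _∸_; _<_; zero; suc; s≤s)
open import Data.Nat.Properties using (suc-injective)
open import Data.Bool using (Bool; true; false; T?; _xor_)
open import Data.Bool.Properties using (T-≡; xor-same; xor-comm) renaming (_≟_ to _≟ᵇ_)
open import Data.Fin using (Fin; zero; suc; _≟_)
open import Data.Fin.Properties using (any?; all?; ¬∀⟶∃¬; pigeonhole; <⇒≢)
open import Data.Fin.Subset using (Subset; _∈_; _∉_; ∣_∣; ⊤; ∁; ⁅_⁆; inside; outside)
open import Data.Fin.Subset.Properties
  using (∈⊤; x∈⁅x⁆; x∈p⇒x∉∁p; x∉p⇒x∈∁p; x≢y⇒x∉⁅y⁆; ∣∁p∣≡n∸∣p∣; ∣⁅x⁆∣≡1; ∣p∣≡n⇒p≡⊤)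
open import Data.Vec using ([]; _∷_; here; there; lookup)
open import Data.List using (List; []; _∷_; length; filterᵇ)
open import Data.List.Membership.Propositional using () renaming (_∈_ to _∈ₗ_)
open import Data.List.Membership.Propositional.Properties using (∈-filter⁺; ∈-filter⁻; ∈-allFin)
open import Data.List.Relation.Unary.All using (All; []; _∷_) renaming (map to all-map; lookup to all-lookup)
open import Data.List.Relation.Unary.Any using () renaming (here to hereₗ; there to thereₗ)
open import Data.List.Relation.Unary.AllPairs using (_∷_)
open import Data.List.Relation.Unary.Unique.Propositional using (Unique)
open import Data.List.Relation.Unary.Unique.Propositional.Properties using (allFin⁺)
open import Data.Product using (_×_; _,_; proj₁; proj₂; ∃; ∃₂)
open import Data.Sum using (_⊎_; inj₁; inj₂)
open import Data.Empty using (⊥-elim)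
open import Function using (_∘_)
open import Function.Bundles using (_⇔_; mk⇔; Equivalence)
open import Relation.Nullary using (¬_; Dec; yes; no; does; ¬?)
open import Relation.Nullary.Decidable using (dec-true; dec-false; _→-dec_)
open import Relation.Binary.PropositionalEquality using (_≡_; _≢_; refl; sym; trans; cong; subst)
open Relation.Binary.PropositionalEquality.≡-Reasoning

singleton : {A : Set} (ys : List A) → length ys ≡ 1 → ∃ λ w → ys ≡ w ∷ []
singleton (w ∷ []) refl = w , refl

single-passing : {A : Set} (p : A → Bool) (xs : List A) → length (filterᵇ p xs) ≡ 1 →
  ∃ λ w → p w ≡ true × (∀ w' → w' ∈ₗ xs → p w' ≡ true → w' ≡ w)
single-passing p xs len with singleton (filterᵇ p xs) len
... | w , filtered≡[w] = w , passes , only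
  where
  passes : p w ≡ true
  passes = Equivalence.to T-≡ (proj₂ (∈-filter⁻ (T? ∘ p) {xs = xs}
             (subst (w ∈ₗ_) (sym filtered≡[w]) (hereₗ refl))))
  only : ∀ w' → w' ∈ₗ xs → p w' ≡ true → w' ≡ w
  only w' w'∈xs pw' with subst (w' ∈ₗ_) filtered≡[w] (∈-filter⁺ (T? ∘ p) w'∈xs (Equivalence.from T-≡ pw'))
  ... | hereₗ w'≡w = w'≡w

none-passing : {A : Set} {p : A → Bool} {xs : List A} → All (λ w → p w ≢ true) xs →
  length (filterᵇ p xs) ≡ 0
none-passing [] = refl
none-passing {p = p} {y ∷ ys} (¬py ∷ rest) with p y
... | true = ⊥-elim (¬py refl)
... | false = none-passing rest

exactly-one-passing : {A : Set} {p : A → Bool} {xs : List A} {x : A} → Unique xs → x ∈ₗ xs →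
  p x ≡ true → (∀ w → p w ≡ true → w ≡ x) → length (filterᵇ p xs) ≡ 1
exactly-one-passing {p = p} {y ∷ ys} (y∉ys ∷ _) (hereₗ refl) px only rewrite px =
  cong suc (none-passing (all-map (λ {w} y≢w pw → y≢w (sym (only w pw))) y∉ys))
exactly-one-passing {p = p} {y ∷ ys} (y∉ys ∷ uniq) (thereₗ x∈ys) px only with p y in py
... | true = ⊥-elim (all-lookup y∉ys x∈ys (only y py))
... | false = exactly-one-passing uniq x∈ys px only

degree-one⇒unique-neighbour : ∀ {n} {G : Graph n} (T : Subgraph G) (v : Fin n) → degree T v ≡ 1 →
  ∃ λ w → eset T v w ≡ true × (∀ w' → eset T v w' ≡ true → w' ≡ w)
degree-one⇒unique-neighbour T v deg with single-passing (eset T v) _ deg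
... | w , vw , only = w , vw , λ w' vw' → only w' (∈-allFin w') vw'

unique-neighbour⇒degree-one : ∀ {n} {G : Graph n} (T : Subgraph G) (v x : Fin n) →
  eset T v x ≡ true → (∀ w → eset T v w ≡ true → w ≡ x) → degree T v ≡ 1
unique-neighbour⇒degree-one {n} T v x vx only = exactly-one-passing (allFin⁺ n) (∈-allFin x) vx only

not-onto : ∀ {k n} → k < n → (f : Fin k → Fin n) → ¬ (∀ z → ∃ λ i → f i ≡ z)
not-onto k<n f onto with pigeonhole k<n (proj₁ ∘ onto)
... | i , j , i<j , same = <⇒≢ i<j (begin
  i                 ≡⟨ sym (proj₂ (onto i)) ⟩
  f (proj₁ (onto i)) ≡⟨ cong f same ⟩
  f (proj₁ (onto j)) ≡⟨ proj₂ (onto j) ⟩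
  j                 ∎)

missing-vertex : ∀ {k n} → k < n → (f : Fin k → Fin n) → ∃ λ z → ∀ i → f i ≢ z
missing-vertex {n = n} k<n f
  with ¬∀⟶∃¬ n (λ z → ∃ λ i → f i ≡ z) (λ z → any? (λ i → f i ≟ z)) (not-onto k<n f)
... | z , unhit = z , λ i fi≡z → unhit (i , fi≡z)

fourth-vertex : ∀ {n} → 4 ≤ n → (a b c : Fin n) → ∃ λ z → z ≢ a × z ≢ b × z ≢ c
fourth-vertex 4≤n a b c with missing-vertex 4≤n (lookup (a ∷ b ∷ c ∷ []))
... | z , unhit = z , unhit zero ∘ sym , unhit (suc zero) ∘ sym , unhit (suc (suc zero)) ∘ sym

AllBut : ∀ {n} → Subset n → Fin n → Set
AllBut S x = x ∉ S × (∀ y → y ≢ x → y ∈ S)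

allBut-∁⁅⁆ : ∀ {n} (x : Fin n) → AllBut (∁ ⁅ x ⁆) x
allBut-∁⁅⁆ x = x∈p⇒x∉∁p (x∈⁅x⁆ x) , λ y y≢x → x∉p⇒x∈∁p (x≢y⇒x∉⁅y⁆ y≢x)

∣∁⁅x⁆∣≡n-1 : ∀ {m} (x : Fin (suc m)) → ∣ ∁ ⁅ x ⁆ ∣ ≡ m
∣∁⁅x⁆∣≡n-1 {m} x = trans (∣∁p∣≡n∸∣p∣ ⁅ x ⁆) (cong (suc m ∸_) (∣⁅x⁆∣≡1 x))

allBut-of-size : ∀ {m} (S : Subset (suc m)) → ∣ S ∣ ≡ m → ∃ (AllBut S)
allBut-of-size (outside ∷ S) |S|≡m = zero , (λ ()) , rest-inside
  where
  rest-inside : ∀ y → y ≢ zero → y ∈ (outside ∷ S)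
  rest-inside zero y≢0 = ⊥-elim (y≢0 refl)
  rest-inside (suc y) _ = there (subst (y ∈_) (sym (∣p∣≡n⇒p≡⊤ |S|≡m)) ∈⊤)
allBut-of-size {zero} (inside ∷ S) ()
allBut-of-size {suc m} (inside ∷ S) |S|≡m with allBut-of-size S (suc-injective |S|≡m)
... | x , x∉S , others = suc x , (λ { (there x∈S) → x∉S x∈S }) , shifted
  where
  shifted : ∀ y → y ≢ suc x → y ∈ (inside ∷ S)
  shifted zero _ = here
  shifted (suc y) y≢x = there (others y (y≢x ∘ cong suc))

pair-closed : ∀ {n} {E : Fin n → Fin n → Bool} {v w a b : Fin n} →
  (∀ c → E v c ≡ true → c ≡ w) → (∀ c → E w c ≡ true → c ≡ v) →
  Reach E a b → a ≡ v ⊎ a ≡ w → b ≡ v ⊎ b ≡ w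
pair-closed only-w only-v here a∈vw = a∈vw
pair-closed only-w only-v (step {v = c} ac walk) (inj₁ refl) = pair-closed only-w only-v walk (inj₂ (only-w c ac))
pair-closed only-w only-v (step {v = c} ac walk) (inj₂ refl) = pair-closed only-w only-v walk (inj₁ (only-v c ac))

module PedantTree {n : ℕ} {G : Graph n} {S : Subset n} {x : Fin n}
                  (S=V∖x : AllBut S x) (4≤n : 4 ≤ n)
                  (T : Subgraph G) (pedant : IsPedantSteiner S T) where

  terminal : ∀ v → v ≢ x → v ∈ S
  terminal = proj₂ S=V∖x

  terminal-neighbour : ∀ v → v ≢ x → ∃ λ w → eset T v w ≡ true × (∀ w' → eset T v w' ≡ true → w' ≡ w)
  terminal-neighbour v v≢x = degree-one⇒unique-neighbour T v (proj₂ (proj₂ pedant) v (terminal v v≢x))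

  terminals-connected : ∀ v z → v ≢ x → z ≢ x → Reach (eset T) v z
  terminals-connected v z v≢x z≢x = proj₁ (proj₁ pedant) v z
    (proj₁ (proj₂ pedant) v (terminal v v≢x)) (proj₁ (proj₂ pedant) z (terminal z z≢x))

  joined-to-centre : ∀ v → v ≢ x → eset T v x ≡ true
  joined-to-centre v v≢x with terminal-neighbour v v≢x
  ... | w , vw , only-w with w ≟ x
  ...   | yes refl = vw
  ...   | no w≢x with terminal-neighbour w w≢x | fourth-vertex 4≤n x v w
  ...     | _ , _ , only-v' | z , z≢x , z≢v , z≢w =
    ⊥-elim (z∉vw (pair-closed only-w only-v (terminals-connected v z v≢x z≢x) (inj₁ refl)))
    where
    only-v : ∀ c → eset T w c ≡ true → c ≡ v
    only-v c wc = trans (only-v' c wc) (sym (only-v' v (esym T v w vw)))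
    z∉vw : ¬ (z ≡ v ⊎ z ≡ w)
    z∉vw (inj₁ z≡v) = z≢v z≡v
    z∉vw (inj₂ z≡w) = z≢w z≡w

  centre-adjacent : ∀ v → v ≢ x → adj G v x ≡ true
  centre-adjacent v v≢x = e⊆G T v x (joined-to-centre v v≢x)

  centre-in-tree : x ∈ vset T
  centre-in-tree with fourth-vertex 4≤n x x x
  ... | v , v≢x , _ = proj₂ (e-endpts T v x (joined-to-centre v v≢x))

tree⇒centre-adjacent : ∀ {n} {G : Graph n} {x : Fin n} → 4 ≤ n → HasPacking G (∁ ⁅ x ⁆) 1 →
  ∀ v → v ≢ x → adj G v x ≡ true
tree⇒centre-adjacent {x = x} 4≤n (T , pedant , _) =
  PedantTree.centre-adjacent (allBut-∁⁅⁆ x) 4≤n (T zero) (pedant zero)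

-- τ_G(V(G) ∖ {x}) ≤ 1: two pedant trees would both contain the non-terminal x.
no-two-trees : ∀ {n} {G : Graph n} {S : Subset n} {x : Fin n} → AllBut S x → 4 ≤ n →
  ¬ HasPacking G S 2
no-two-trees {x = x} S=V∖x 4≤n (T , pedant , disjoint) =
  proj₁ S=V∖x (proj₁ (proj₂ (disjoint zero (suc zero) (λ ()))) x
    (centre-in-tree (T zero) (pedant zero) , centre-in-tree (T (suc zero)) (pedant (suc zero))))
  where open PedantTree S=V∖x 4≤n

-- The star K_{1,n-1} centred at x: exactly the pairs with one endpoint x are edges.
module Star {n : ℕ} (x : Fin n) where

  is-centre : Fin n → Bool
  is-centre u = does (u ≟ x)

  star-edge : Fin n → Fin n → Bool
  star-edge u v = is-centre u xor is-centre v

  edge-at-centre : ∀ u v → star-edge u v ≡ true → u ≡ x ⊎ v ≡ x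
  edge-at-centre u v uv with u ≟ x | v ≟ x
  edge-at-centre u v uv | yes u≡x | _ = inj₁ u≡x
  edge-at-centre u v uv | no _ | yes v≡x = inj₂ v≡x
  edge-at-centre u v () | no _ | no _

  edge-distinct : ∀ u v → star-edge u v ≡ true → u ≢ v
  edge-distinct u .u uu refl with trans (sym uu) (xor-same (is-centre u))
  ... | ()

  to-centre : ∀ u → u ≢ x → star-edge u x ≡ true
  to-centre u u≢x rewrite dec-false (u ≟ x) u≢x | dec-true (x ≟ x) refl = refl

  from-centre : ∀ u → u ≢ x → star-edge x u ≡ true
  from-centre u u≢x = trans (xor-comm (is-centre x) (is-centre u)) (to-centre u u≢x)

  reach-from-centre : ∀ v → Reach star-edge x v
  reach-from-centre v with v ≟ x
  ... | yes refl = here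
  ... | no v≢x = step (from-centre v v≢x) here

  star-connected : ∀ u v → Reach star-edge u v
  star-connected u v with u ≟ x
  ... | yes refl = reach-from-centre v
  ... | no u≢x = step (to-centre u u≢x) (reach-from-centre v)

  middle-is-centre : ∀ v₀ v₁ v₂ → v₀ ≢ v₂ → star-edge v₀ v₁ ≡ true → star-edge v₁ v₂ ≡ true → v₁ ≡ x
  middle-is-centre v₀ v₁ v₂ v₀≢v₂ e₀₁ e₁₂ with edge-at-centre v₀ v₁ e₀₁ | edge-at-centre v₁ v₂ e₁₂
  ... | inj₂ v₁≡x | _ = v₁≡x
  ... | inj₁ _ | inj₁ v₁≡x = v₁≡x
  ... | inj₁ v₀≡x | inj₂ v₂≡x = ⊥-elim (v₀≢v₂ (trans v₀≡x (sym v₂≡x)))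

  -- A cycle would need a further edge v₂v₀ or v₂v₃ avoiding the centre v₁.
  star-acyclic : ∀ c → ¬ IsCycle star-edge c
  star-acyclic (_ ∷ []) (s≤s () , _)
  star-acyclic (_ ∷ _ ∷ []) (s≤s (s≤s ()) , _)
  star-acyclic (v₀ ∷ v₁ ∷ v₂ ∷ [])
    (_ , (v₀≢v₁ ∷ v₀≢v₂ ∷ _) ∷ (v₁≢v₂ ∷ _) ∷ _ , e₀₁ ∷ e₁₂ ∷ _ , e₂₀)
    with middle-is-centre v₀ v₁ v₂ v₀≢v₂ e₀₁ e₁₂ | edge-at-centre v₂ v₀ e₂₀
  ... | v₁≡x | inj₁ v₂≡x = v₁≢v₂ (trans v₁≡x (sym v₂≡x))
  ... | v₁≡x | inj₂ v₀≡x = v₀≢v₁ (trans v₀≡x (sym v₁≡x))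
  star-acyclic (v₀ ∷ v₁ ∷ v₂ ∷ v₃ ∷ _)
    (_ , (_ ∷ v₀≢v₂ ∷ _) ∷ (v₁≢v₂ ∷ v₁≢v₃ ∷ _) ∷ _ , e₀₁ ∷ e₁₂ ∷ e₂₃ ∷ _ , _)
    with middle-is-centre v₀ v₁ v₂ v₀≢v₂ e₀₁ e₁₂ | edge-at-centre v₂ v₃ e₂₃
  ... | v₁≡x | inj₁ v₂≡x = v₁≢v₂ (trans v₁≡x (sym v₂≡x))
  ... | v₁≡x | inj₂ v₃≡x = v₁≢v₃ (trans v₁≡x (sym v₃≡x))

  star : (G : Graph n) → Complete G → Subgraph G
  star G complete = record
    { vset     = ⊤
    ; eset     = star-edge
    ; esym     = λ u v uv → trans (xor-comm (is-centre v) (is-centre u)) uv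
    ; e⊆G      = λ u v uv → complete u v (edge-distinct u v uv)
    ; e-endpts = λ _ _ _ → ∈⊤ , ∈⊤
    }

  star-pedant : ∀ (G : Graph n) {S : Subset n} (complete : Complete G) → AllBut S x →
    IsPedantSteiner S (star G complete)
  star-pedant G {S} complete (x∉S , _) =
    ((λ u v _ _ → star-connected u v) , star-acyclic) , (λ _ _ → ∈⊤) , leaf
    where
    leaf : ∀ v → v ∈ S → degree (star G complete) v ≡ 1
    leaf v v∈S = unique-neighbour⇒degree-one (star G complete) v x (to-centre v v≢x) only-centre
      where
      v≢x : v ≢ x
      v≢x refl = x∉S v∈S
      only-centre : ∀ w → star-edge v w ≡ true → w ≡ x
      only-centre w vw with edge-at-centre v w vw
      ... | inj₁ v≡x = ⊥-elim (v≢x v≡x)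
      ... | inj₂ w≡x = w≡x

empty-packing : ∀ {n} {G : Graph n} {S : Subset n} → HasPacking G S 0
empty-packing = (λ ()) , (λ ()) , (λ ())

single-packing : ∀ {n} {G : Graph n} {S : Subset n} (T : Subgraph G) → IsPedantSteiner S T →
  HasPacking G S 1
single-packing T pedant = (λ _ → T) , (λ _ → pedant) , λ { zero zero 0≢0 → ⊥-elim (0≢0 refl) }

-- In K_n every (n-1)-set S carries a pedant S-Steiner tree: the star at the missing vertex.
complete⇒tree : ∀ {m} {G : Graph (suc m)} → Complete G → ∀ S → ∣ S ∣ ≡ m → HasPacking G S 1
complete⇒tree {G = G} complete S |S|≡m with allBut-of-size S |S|≡m
... | x , S=V∖x = single-packing (Star.star x G complete) (Star.star-pedant x G complete S=V∖x)

-- "u and v are adjacent unless equal" is decidable, so a graph that is not complete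
-- has an explicit non-adjacent pair of distinct vertices.
adjacent-unless-equal? : ∀ {n} (G : Graph n) (u v : Fin n) → Dec (u ≢ v → adj G u v ≡ true)
adjacent-unless-equal? G u v = ¬? (u ≟ v) →-dec (adj G u v ≟ᵇ true)

nonadjacent-pair : ∀ {n} (G : Graph n) → ¬ Complete G → ∃₂ λ u v → u ≢ v × adj G u v ≢ true
nonadjacent-pair {n} G incomplete
  with ¬∀⟶∃¬ n _ (λ u → all? (adjacent-unless-equal? G u)) incomplete
... | u , not-universal with ¬∀⟶∃¬ n _ (adjacent-unless-equal? G u) not-universal
... | v , missing = u , v , (λ u≡v → missing (λ u≢v → ⊥-elim (u≢v u≡v))) , (λ uv → missing (λ _ → uv))

corollary2 : (n : ℕ) (G : Graph n) → 4 ≤ n → Connected G →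
    (Tau≡ G (n ∸ 1) 1 ⇔ Complete G) × (Tau≡ G (n ∸ 1) 0 ⇔ (¬ Complete G))
corollary2 (suc m) G 4≤n _ = mk⇔ τ≡1⇒complete complete⇒τ≡1 , mk⇔ τ≡0⇒incomplete incomplete⇒τ≡0
  where
  τ≡1⇒complete : Tau≡ G m 1 → Complete G
  τ≡1⇒complete (tree-for , _) u v u≢v =
    tree⇒centre-adjacent 4≤n (tree-for (∁ ⁅ v ⁆) (∣∁⁅x⁆∣≡n-1 v)) u u≢v

  complete⇒τ≡1 : Complete G → Tau≡ G m 1
  complete⇒τ≡1 complete =
    complete⇒tree complete , ∁ ⁅ zero ⁆ , ∣∁⁅x⁆∣≡n-1 zero ,
    complete⇒tree complete _ (∣∁⁅x⁆∣≡n-1 zero) , no-two-trees (allBut-∁⁅⁆ zero) 4≤n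

  τ≡0⇒incomplete : Tau≡ G m 0 → ¬ Complete G
  τ≡0⇒incomplete (_ , S , |S|≡m , _ , no-tree) complete = no-tree (complete⇒tree complete S |S|≡m)

  incomplete⇒τ≡0 : ¬ Complete G → Tau≡ G m 0
  incomplete⇒τ≡0 incomplete with nonadjacent-pair G incomplete
  ... | u , v , u≢v , ¬uv =
    (λ _ _ → empty-packing) , ∁ ⁅ v ⁆ , ∣∁⁅x⁆∣≡n-1 v , empty-packing ,
    λ tree → ¬uv (tree⇒centre-adjacent 4≤n tree u u≢v)
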